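{- There exist an $\mathcal{EL}$ axiom $\alpha$ and a sequence of $\mathcal{EL}$ ontologies $\mathfrak{O}^{(n)}=\mathfrak{O}_s^{(n)}\cup\mathfrak{O}_r^{(n)}$ ($n\ge1$) with $\mathfrak{O}_s^{(n)}=\emptyset$ and $\mathfrak{O}^{(n)}\models\alpha$, such that the modified gentle repair algorithm applied to $\mathfrak{O}^{(n)}$ and $\alpha$ has a run whose number of iterations is exponential in the size of $\mathfrak{O}^{(n)}$.
   Context: $\mathcal{EL}$ concepts: $C::=A\mid\top\mid C\sqcap C\mid\exists r.C$ with $A$ a concept name and $r$ a role name; axioms are GCIs $C\sqsubseteq D$ and assertions $C(a)$, $r(a,b)$, with the usual set-theoretic semantics ($\top^\mathcal{I}=\Delta^\mathcal{I}$, $\sqcap$ as intersection, $(\exists r.C)^\mathcal{I}=\{d\mid\exists e\in C^\mathcal{I},(d,e)\in r^\mathcal{I}\}$). An ontology is a finite set of axioms, $\mathfrak{O}\models\alpha$ means every model of $\mathfrak{O}$ satisfies $\alpha$, $\mathit{Con}(\mathfrak{O})=\{\alpha\mid\mathfrak{O}\models\alpha\}$; sizes of concepts count occurrences of $\top$, concept names and role names, and the size of an ontology is the sum of the sizes of its axioms. An ontology is split as $\mathfrak{O}=\mathfrak{O}_s\cup\mathfrak{O}_r$ (static and refutable part). A justification for $\alpha$ is an inclusion-minimal $J\subseteq\mathfrak{O}_r$ with $\mathfrak{O}_s\cup J\models\alpha$. An axiom $\gamma$ is weaker than $\beta$ if $\mathit{Con}(\{\gamma\})\subsetneq\mathit{Con}(\{\beta\})$.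 The modified gentle repair algorithm: while $\mathfrak{O}_s\cup\mathfrak{O}_r\models\alpha$, pick one justification $J$ for $\alpha$ and an axiom $\beta\in J$, and replace $\beta$ in $\mathfrak{O}_r$ by an axiom $\gamma$ weaker than $\beta$ with $\mathfrak{O}_s\cup(J\setminus\{\beta\})\cup\{\gamma\}\not\models\alpha$; each replacement is one iteration. -}

module Defs where

open import Data.Nat using (ℕ; suc; _+_)
open import Data.List using (List; []; _∷_)
open import Data.List.Membership.Propositional using (_∈_)
open import Data.Product using (Σ; _×_; ∃-syntax)
open import Data.Sum using (_⊎_)
open import Data.Unit using (⊤)
open import Relation.Nullary using (¬_)
open import Relation.Binary.PropositionalEquality using (_≡_; _≢_)

ConceptName RoleName IndName : Set
ConceptName = ℕ
RoleName = ℕ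
IndName = ℕ

data Concept : Set where
  atom : ConceptName → Concept
  ⊤c   : Concept
  _⊓_  : Concept → Concept → Concept
  ex : RoleName → Concept → Concept

data Axiom : Set where
  _⊑_    : Concept → Concept → Axiom
  cassert : Concept → IndName → Axiom
  rassert : RoleName → IndName → IndName → Axiom

Ontology : Set
Ontology = List Axiom

record Interpretation : Set₁ where
  field
    Δ    : Set
    conI : ConceptName → Δ → Set
    roleI : RoleName → Δ → Δ → Set
    indI : IndName → Δ

open Interpretation

⟦_⟧ : Concept → (I : Interpretation) → Δ I → Set
⟦ atom A ⟧ I d = conI I A d
⟦ ⊤c ⟧ I d = ⊤
⟦ C ⊓ D ⟧ I d = ⟦ C ⟧ I d × ⟦ D ⟧ I d
⟦ ex r C ⟧ I d = Σ (Δ I) (λ e → roleI I r d e × ⟦ C ⟧ I e)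

_⊩_ : Interpretation → Axiom → Set
I ⊩ (C ⊑ D) = ∀ d → ⟦ C ⟧ I d → ⟦ D ⟧ I d
I ⊩ cassert C a = ⟦ C ⟧ I (indI I a)
I ⊩ rassert r a b = roleI I r (indI I a) (indI I b)

-- Entailment from a (possibly infinite) set of axioms given as a predicate.
_⊨ₚ_ : (Axiom → Set) → Axiom → Set₁
S ⊨ₚ α = ∀ (I : Interpretation) → (∀ β → S β → I ⊩ β) → I ⊩ α

_⊨_ : Ontology → Axiom → Set₁
O ⊨ α = (λ β → β ∈ O) ⊨ₚ α

_∪ₚ_ : Ontology → Ontology → (Axiom → Set)
(O₁ ∪ₚ O₂) β = β ∈ O₁ ⊎ β ∈ O₂

_⊆_ : Ontology → Ontology → Set
J ⊆ O = ∀ {β} → β ∈ J → β ∈ O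

IsJustification : (Os Or J : Ontology) (α : Axiom) → Set₁
IsJustification Os Or J α =
  J ⊆ Or × ((Os ∪ₚ J) ⊨ₚ α) ×
  (∀ (J' : Ontology) → J' ⊆ J → (Os ∪ₚ J') ⊨ₚ α → J ⊆ J')

Weaker : Axiom → Axiom → Set₁
Weaker γ β =
  (∀ δ → (γ ∷ []) ⊨ δ → (β ∷ []) ⊨ δ) × (∃[ δ ] ((β ∷ []) ⊨ δ × ¬ ((γ ∷ []) ⊨ δ)))

-- One iteration of the modified gentle repair algorithm, turning the
-- refutable part Or into Or' (static part Os, unwanted consequence α).
RepairStep : (Os : Ontology) (α : Axiom) (Or Or' : Ontology) → Set₁
RepairStep Os α Or Or' =
  ((Os ∪ₚ Or) ⊨ₚ α) ×
  ∃[ J ] ∃[ β ] ∃[ γ ]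
    ( IsJustification Os Or J α × β ∈ J × Weaker γ β
    × ¬ ((λ δ → δ ∈ Os ⊎ (δ ∈ J × δ ≢ β) ⊎ δ ≡ γ) ⊨ₚ α)
    × (∀ δ → δ ∈ Or' → (δ ∈ Or × δ ≢ β) ⊎ δ ≡ γ)
    × (∀ δ → (δ ∈ Or × δ ≢ β) ⊎ δ ≡ γ → δ ∈ Or'))

data Run (Os : Ontology) (α : Axiom) : Ontology → ℕ → Set₁ where
  done : ∀ {Or} → ¬ ((Os ∪ₚ Or) ⊨ₚ α) → Run Os α Or 0
  step : ∀ {Or Or' k} → RepairStep Os α Or Or' → Run Os α Or' k → Run Os α Or (suc k)

conceptSize : Concept → ℕ
conceptSize (atom A) = 1
conceptSize ⊤c = 1
conceptSize (C ⊓ D) = conceptSize C + conceptSize D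
conceptSize (ex r C) = suc (conceptSize C)

axiomSize : Axiom → ℕ
axiomSize (C ⊑ D) = conceptSize C + conceptSize D
axiomSize (cassert C a) = conceptSize C
axiomSize (rassert r a b) = 1

ontologySize : Ontology → ℕ
ontologySize [] = 0
ontologySize (β ∷ O) = axiomSize β + ontologySize O

-- A bit vector c of length m is encoded by the axioms K c: a chain N_m ⊑ ∃r.(N_{m-1} ⊓ V), …,
-- N_0 ⊑ ∃r.V with a side edge N_i ⊑ ∃r.U at every 1 of c, plus A ⊑ N_m, N_m ⊑ ∃s.U and a
-- U-loop that makes U satisfy every Above b. Then N_m entails Above b exactly when b ≼ c in the
-- lexicographic order. The refutable part is K 1…1 together with one GCI
-- β⟨bs⟩ = A ⊓ Above b₁ ⊓ … ⊓ ∃s.∃r.V ⊑ B. If c is the largest vector in bs, then β⟨bs⟩ ∪ K c is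
-- a justification for α = A ⊑ B, and replacing β⟨bs⟩ by β⟨d ∷ bs⟩ for the successor d of c is
-- a legal repair step: N_m is not Above d in the countermodel of K c. Walking through all 2^m
-- vectors takes 2^m iterations on an ontology of size 19 + 8m.
module Submission where

open import Defs
open import Data.Bool using (Bool; true; false)
open import Data.Empty using (⊥; ⊥-elim)
open import Data.List using (List; []; _∷_; [_]; length; map; _++_)
open import Data.List.Properties using (length-++; length-map)
open import Data.List.Membership.Propositional using (_∈_; _∉_)
open import Data.List.Relation.Binary.Subset.Propositional.Properties using (∷⁺ʳ)
open import Data.List.Relation.Unary.All as All using (All; []; _∷_)
open import Data.List.Relation.Unary.AllPairs as AllPairs using (AllPairs)
import Data.List.Relation.Unary.AllPairs.Properties as AllPairs
import Data.List.Relation.Unary.All.Properties as All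
open import Data.List.Relation.Unary.Any using (here; there)
open import Data.List.Relation.Unary.Linked using (Linked; [-]; _∷_)
open import Data.List.Relation.Unary.Linked.Properties using (AllPairs⇒Linked)
open import Data.Nat using (ℕ; zero; suc; _+_; _*_; _^_; _≤_; _≟_; z≤n; s≤s)
open import Data.Nat.Properties
  using (≤-refl; m≤n⇒m≤1+n; 1+n≰n; m≤m*n; m≤n*m; m≤n+m; ≤-trans; +-monoˡ-≤; *-distribˡ-+; +-identityʳ; ^-*-assoc; ^-monoʳ-≤)
open import Data.Nat.Tactic.RingSolver using (solve-∀)
open import Data.Product using (Σ; _×_; _,_; proj₂; ∃-syntax; uncurry)
open import Data.Sum using (_⊎_; inj₁; inj₂)
open import Data.Unit using (⊤; tt)
open import Data.Vec using (Vec; []; _∷_; replicate)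
open import Function using (id)
open import Relation.Binary.Definitions using (DecidableEquality)
open import Relation.Binary.PropositionalEquality using (_≡_; _≢_; refl; sym; trans; cong; cong₂; subst; module ≡-Reasoning)
open import Relation.Nullary using (¬_; Dec; yes; no)
open import Relation.Nullary.Decidable using (map′; _×-dec_; ¬?)

open Interpretation

variable
  i j k m : ℕ
  b c d : Vec Bool k
  bs : List (Vec Bool k)
  I : Interpretation
  γ δ ε : Axiom
  J O : Ontology

_≟ᶜ_ : DecidableEquality Concept
atom A₁ ≟ᶜ atom A₂ = map′ (cong atom) (λ { refl → refl }) (A₁ ≟ A₂)
⊤c ≟ᶜ ⊤c = yes refl
(C₁ ⊓ D₁) ≟ᶜ (C₂ ⊓ D₂) = map′ (uncurry (cong₂ _⊓_)) (λ { refl → refl , refl }) (C₁ ≟ᶜ C₂ ×-dec D₁ ≟ᶜ D₂)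
ex r₁ C₁ ≟ᶜ ex r₂ C₂ = map′ (uncurry (cong₂ ex)) (λ { refl → refl , refl }) (r₁ ≟ r₂ ×-dec C₁ ≟ᶜ C₂)
atom _ ≟ᶜ ⊤c = no λ ()
atom _ ≟ᶜ (_ ⊓ _) = no λ ()
atom _ ≟ᶜ ex _ _ = no λ ()
⊤c ≟ᶜ atom _ = no λ ()
⊤c ≟ᶜ (_ ⊓ _) = no λ ()
⊤c ≟ᶜ ex _ _ = no λ ()
(_ ⊓ _) ≟ᶜ atom _ = no λ ()
(_ ⊓ _) ≟ᶜ ⊤c = no λ ()
(_ ⊓ _) ≟ᶜ ex _ _ = no λ ()
ex _ _ ≟ᶜ atom _ = no λ ()
ex _ _ ≟ᶜ ⊤c = no λ ()
ex _ _ ≟ᶜ (_ ⊓ _) = no λ ()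

_≟ᵃ_ : DecidableEquality Axiom
(C₁ ⊑ D₁) ≟ᵃ (C₂ ⊑ D₂) = map′ (uncurry (cong₂ _⊑_)) (λ { refl → refl , refl }) (C₁ ≟ᶜ C₂ ×-dec D₁ ≟ᶜ D₂)
cassert C₁ a₁ ≟ᵃ cassert C₂ a₂ = map′ (uncurry (cong₂ cassert)) (λ { refl → refl , refl }) (C₁ ≟ᶜ C₂ ×-dec a₁ ≟ a₂)
rassert r₁ a₁ b₁ ≟ᵃ rassert r₂ a₂ b₂ =
  map′ (λ { (refl , refl , refl) → refl }) (λ { refl → refl , refl , refl }) (r₁ ≟ r₂ ×-dec a₁ ≟ a₂ ×-dec b₁ ≟ b₂)
(_ ⊑ _) ≟ᵃ cassert _ _ = no λ ()
(_ ⊑ _) ≟ᵃ rassert _ _ _ = no λ ()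
cassert _ _ ≟ᵃ (_ ⊑ _) = no λ ()
cassert _ _ ≟ᵃ rassert _ _ _ = no λ ()
rassert _ _ _ ≟ᵃ (_ ⊑ _) = no λ ()
rassert _ _ _ ≟ᵃ cassert _ _ = no λ ()

open import Data.List.Membership.DecPropositional _≟ᵃ_ using (_∈?_)

B U V A : ConceptName
B = 0
U = 1
V = 2
A = 3

N : ℕ → ConceptName
N i = 4 + i

r s : RoleName
r = 0
s = 1

Above : Vec Bool k → Concept
Above [] = ex r (atom V)
Above (false ∷ b) = ex r (Above b)
Above (true ∷ b) = ex r (atom U) ⊓ ex r (atom V ⊓ Above b)

∃s∃rV : Concept
∃s∃rV = ex s (ex r (atom V))

AboveAll : List (Vec Bool k) → Concept
AboveAll [] = ∃s∃rV
AboveAll (b ∷ bs) = Above b ⊓ AboveAll bs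

α : Axiom
α = atom A ⊑ atom B

β⟨_⟩ : List (Vec Bool k) → Axiom
β⟨ bs ⟩ = (atom A ⊓ AboveAll bs) ⊑ atom B

entry spur : ℕ → Axiom
entry m = atom A ⊑ atom (N m)
spur m = atom (N m) ⊑ ex s (atom U)

loop : Axiom
loop = atom U ⊑ ex r (atom U ⊓ atom V)

descend branch : ℕ → Axiom
descend j = atom (N (suc j)) ⊑ ex r (atom (N j) ⊓ atom V)
branch i = atom (N i) ⊑ ex r (atom U)

bottom : Axiom
bottom = atom (N 0) ⊑ ex r (atom V)

chain : Vec Bool k → Ontology
chain [] = [ bottom ]
chain {suc k} (false ∷ c) = descend k ∷ chain c
chain {suc k} (true ∷ c) = descend k ∷ branch (suc k) ∷ chain c

K : Vec Bool m → Ontology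
K {m} c = entry m ∷ spur m ∷ loop ∷ chain c

ones zeros : (m : ℕ) → Vec Bool m
ones m = replicate m true
zeros m = replicate m false

𝔒 : ℕ → Ontology
𝔒 m = β⟨ [ zeros m ] ⟩ ∷ K (ones m)

⊤⊑⊤ : Axiom
⊤⊑⊤ = ⊤c ⊑ ⊤c

infix 4 _≼_ _≺_

data _≼_ : Vec Bool k → Vec Bool k → Set where
  [] : [] ≼ []
  0≼1 : false ∷ b ≼ true ∷ c
  _∷_ : ∀ x → b ≼ c → x ∷ b ≼ x ∷ c

data _≺_ : Vec Bool k → Vec Bool k → Set where
  0≺1 : false ∷ b ≺ true ∷ c
  _∷_ : ∀ x → b ≺ c → x ∷ b ≺ x ∷ c

≼-refl : c ≼ c
≼-refl {c = []} = []
≼-refl {c = x ∷ c} = x ∷ ≼-refl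

≼-trans : b ≼ c → c ≼ d → b ≼ d
≼-trans [] [] = []
≼-trans 0≼1 (_ ∷ _) = 0≼1
≼-trans (_ ∷ _) 0≼1 = 0≼1
≼-trans (x ∷ p) (_ ∷ q) = x ∷ ≼-trans p q

≺⇒≼ : b ≺ c → b ≼ c
≺⇒≼ 0≺1 = 0≼1
≺⇒≼ (x ∷ p) = x ∷ ≺⇒≼ p

≺⇒⋡ : b ≺ c → ¬ c ≼ b
≺⇒⋡ (_ ∷ p) (_ ∷ q) = ≺⇒⋡ p q

≼-ones : c ≼ ones k
≼-ones {c = []} = []
≼-ones {c = false ∷ c} = 0≼1
≼-ones {c = true ∷ c} = true ∷ ≼-ones

U⊑Above : I ⊩ loop → (b : Vec Bool k) → ∀ d → conI I U d → ⟦ Above b ⟧ I d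
U⊑Above I⊩loop b d Ud with I⊩loop d Ud
U⊑Above I⊩loop [] d Ud | e , de , (_ , Ve) = e , de , Ve
U⊑Above I⊩loop (false ∷ b) d Ud | e , de , (Ue , _) = e , de , U⊑Above I⊩loop b e Ue
U⊑Above I⊩loop (true ∷ b) d Ud | e , de , (Ue , Ve) = (e , de , Ue) , (e , de , (Ve , U⊑Above I⊩loop b e Ue))

chain⊑Above : ∀ {k} {b c : Vec Bool k} → I ⊩ loop → b ≼ c → All (I ⊩_) (chain c) → ∀ d → conI I (N k) d → ⟦ Above b ⟧ I d
chain⊑Above I⊩loop [] (I⊩bottom ∷ []) = I⊩bottom
chain⊑Above {b = false ∷ b} I⊩loop 0≼1 (_ ∷ I⊩branch ∷ _) d Nd with I⊩branch d Nd
... | e , de , Ue = e , de , U⊑Above I⊩loop b e Ue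
chain⊑Above I⊩loop (false ∷ p) (I⊩descend ∷ I⊩chain) d Nd with I⊩descend d Nd
... | e , de , (Ne , _) = e , de , chain⊑Above I⊩loop p I⊩chain e Ne
chain⊑Above I⊩loop (true ∷ p) (I⊩descend ∷ I⊩branch ∷ I⊩chain) d Nd with I⊩descend d Nd
... | e , de , (Ne , Ve) = I⊩branch d Nd , (e , de , (Ve , chain⊑Above I⊩loop p I⊩chain e Ne))

K⊨α : All (_≼ c) bs → (β⟨ bs ⟩ ∷ K c) ⊨ α
K⊨α {c = c} {bs = bs} bs≼c I I⊩ d Ad = I⊩ _ (here refl) d (Ad , aboveAll bs bs≼c)
  where
  I⊩K : ε ∈ K c → I ⊩ ε
  I⊩K p = I⊩ _ (there p)
  I⊩loop = I⊩K (there (there (here refl)))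
  Nd = I⊩K (here refl) d Ad
  aboveAll : ∀ bs → All (_≼ c) bs → ⟦ AboveAll bs ⟧ I d
  aboveAll [] [] with I⊩K (there (here refl)) d Nd
  ... | e , de , Ue with I⊩loop e Ue
  ... | f , ef , (_ , Vf) = e , de , (f , ef , Vf)
  aboveAll (b ∷ bs) (b≼c ∷ bs≼c) =
    chain⊑Above I⊩loop b≼c (All.tabulate (λ p → I⊩K (there (there (there p))))) d Nd , aboveAll bs bs≼c

⊨⇒∪ₚ⊨ : J ⊆ O → J ⊨ δ → ([] ∪ₚ O) ⊨ₚ δ
⊨⇒∪ₚ⊨ J⊆O J⊨δ I I⊩O = J⊨δ I λ ε ε∈J → I⊩O ε (inj₂ (J⊆O ε∈J))

AboveAll⇒∃s∃rV : ∀ {d} (bs : List (Vec Bool k)) → ⟦ AboveAll bs ⟧ I d → ⟦ ∃s∃rV ⟧ I d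
AboveAll⇒∃s∃rV [] h = h
AboveAll⇒∃s∃rV (_ ∷ bs) (_ , h) = AboveAll⇒∃s∃rV bs h

branch-height : {c : Vec Bool k} → branch i ∈ chain c → i ≤ k
branch-height {c = []} (here ())
branch-height {c = false ∷ _} (there p) = m≤n⇒m≤1+n (branch-height p)
branch-height {c = true ∷ _} (there (here refl)) = ≤-refl
branch-height {c = true ∷ _} (there (there p)) = m≤n⇒m≤1+n (branch-height p)

branch-∉-zero-bit : {c : Vec Bool k} → branch (suc k) ∉ chain (false ∷ c)
branch-∉-zero-bit (there p) = 1+n≰n (branch-height p)

branch-below : ∀ x {c : Vec Bool k} → i ≤ k → branch i ∈ chain (x ∷ c) → branch i ∈ chain c
branch-below false _ (there p) = p
branch-below true i≤k (there (here refl)) = ⊥-elim (1+n≰n i≤k)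
branch-below true _ (there (there p)) = p


-- node i realises N_i, loopU and loopUV the U-loop, leaf the V-successor of N_0; the isolated
-- point stray carries A exactly when entry m is dropped, so that α always fails.
data Point : Set where
  node : ℕ → Point
  loopU loopUV leaf stray : Point

module Countermodel (m : ℕ) (P : Axiom → Set) where

  IsU IsV IsA : Point → Set
  IsU loopU = ⊤
  IsU loopUV = ⊤
  IsU _ = ⊥
  IsV (node _) = ⊤
  IsV loopUV = ⊤
  IsV leaf = ⊤
  IsV _ = ⊥
  IsA (node i) = i ≡ m × P (entry m)
  IsA stray = ¬ P (entry m)
  IsA _ = ⊥

  IsN : ℕ → Point → Set
  IsN k (node i) = k ≡ i
  IsN _ _ = ⊥

  concept : ConceptName → Point → Set
  concept 0 _ = ⊥
  concept 1 = IsU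
  concept 2 = IsV
  concept 3 = IsA
  concept (suc (suc (suc (suc k)))) = IsN k

  data rEdge : Point → Point → Set where
    descend-edge : P (descend j) → rEdge (node (suc j)) (node j)
    branch-edge : P (branch i) → rEdge (node i) loopU
    bottom-edge : P bottom → rEdge (node zero) leaf
    loop-edge : P loop → rEdge loopU loopUV
    loop-self-edge : P loop → rEdge loopUV loopUV

  data sEdge : Point → Point → Set where
    spur-edge : P (spur m) → sEdge (node m) loopU

  role : RoleName → Point → Point → Set
  role 0 = rEdge
  role 1 = sEdge
  role _ _ _ = ⊥

  M : Interpretation
  M = record { Δ = Point ; conI = concept ; roleI = role ; indI = λ _ → leaf }

  ⊩entry : P (entry m) → M ⊩ entry m
  ⊩entry _ (node i) (refl , _) = refl
  ⊩entry p stray ¬p = ⊥-elim (¬p p)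

  ⊩spur : P (spur m) → M ⊩ spur m
  ⊩spur p (node i) refl = loopU , spur-edge p , tt

  ⊩loop : P loop → M ⊩ loop
  ⊩loop p loopU _ = loopUV , loop-edge p , (tt , tt)
  ⊩loop p loopUV _ = loopUV , loop-self-edge p , (tt , tt)

  ⊩descend : P (descend j) → M ⊩ descend j
  ⊩descend {j} p (node _) refl = node j , descend-edge p , (refl , tt)

  ⊩branch : P (branch i) → M ⊩ branch i
  ⊩branch p (node _) refl = loopU , branch-edge p , tt

  ⊩bottom : P bottom → M ⊩ bottom
  ⊩bottom p (node _) refl = leaf , bottom-edge p , tt

  K-sound : {c : Vec Bool m} → ε ∈ K c → P ε → M ⊩ ε
  K-sound (here refl) = ⊩entry
  K-sound (there (here refl)) = ⊩spur
  K-sound (there (there (here refl))) = ⊩loop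
  K-sound (there (there (there p))) = chain-sound p
    where
    chain-sound : {c : Vec Bool k} → ε ∈ chain c → P ε → M ⊩ ε
    chain-sound {c = []} (here refl) = ⊩bottom
    chain-sound {c = false ∷ _} (here refl) = ⊩descend
    chain-sound {c = false ∷ _} (there p) = chain-sound p
    chain-sound {c = true ∷ _} (here refl) = ⊩descend
    chain-sound {c = true ∷ _} (there (here refl)) = ⊩branch
    chain-sound {c = true ∷ _} (there (there p)) = chain-sound p

  ⊮α : Dec (P (entry m)) → ¬ M ⊩ α
  ⊮α (yes p) M⊩α = M⊩α (node m) (refl , p)
  ⊮α (no ¬p) M⊩α = M⊩α stray ¬p

  ⊩β-if-¬AboveAll : (P (entry m) → ¬ ⟦ AboveAll bs ⟧ M (node m)) → M ⊩ β⟨ bs ⟩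
  ⊩β-if-¬AboveAll ¬above (node i) ((refl , p) , h) = ¬above p h
  ⊩β-if-¬AboveAll {bs = bs} _ stray (_ , h) with AboveAll⇒∃s∃rV bs h
  ... | _ , () , _

  ∃s∃rV⇒spur×loop : ⟦ ∃s∃rV ⟧ M (node i) → P (spur m) × P loop
  ∃s∃rV⇒spur×loop (_ , spur-edge p , _ , loop-edge q , _) = p , q

  Respects : Vec Bool k → Set
  Respects [] = ⊤
  Respects {suc k} (false ∷ c) = ¬ P (branch (suc k)) × Respects c
  Respects (true ∷ c) = Respects c

  above⇒≼ : {b c : Vec Bool k} → Respects c → ⟦ Above b ⟧ M (node k) → b ≼ c
  above⇒≼ {b = []} {[]} _ _ = []
  above⇒≼ {b = false ∷ _} {true ∷ _} _ _ = 0≼1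
  above⇒≼ {b = false ∷ _} {false ∷ _} (_ , resp) (_ , descend-edge _ , h) = false ∷ above⇒≼ resp h
  above⇒≼ {b = false ∷ _} {false ∷ _} (¬branch , _) (_ , branch-edge p , _) = ⊥-elim (¬branch p)
  above⇒≼ {b = true ∷ _} {true ∷ _} resp (_ , (_ , descend-edge _ , (_ , h))) = true ∷ above⇒≼ resp h
  above⇒≼ {b = true ∷ _} {false ∷ _} (¬branch , _) ((_ , branch-edge p , _) , _) = ⊥-elim (¬branch p)

  above-self⇒chain : {c : Vec Bool k} → Respects c → ⟦ Above c ⟧ M (node k) → All P (chain c)
  above-self⇒chain {c = []} _ (_ , bottom-edge p , _) = p ∷ []
  above-self⇒chain {c = false ∷ _} (_ , resp) (_ , descend-edge p , h) = p ∷ above-self⇒chain resp h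
  above-self⇒chain {c = false ∷ _} (¬branch , _) (_ , branch-edge p , _) = ⊥-elim (¬branch p)
  above-self⇒chain {c = true ∷ _} resp ((_ , branch-edge q , _) , (_ , descend-edge p , (_ , h))) =
    p ∷ q ∷ above-self⇒chain resp h

  respects : {c : Vec Bool k} → (∀ {i} → i ≤ k → P (branch i) → branch i ∈ chain c) → Respects c
  respects {c = []} _ = tt
  respects {c = false ∷ _} h = (λ p → branch-∉-zero-bit (h ≤-refl p))
                              , respects (λ i≤k p → branch-below false i≤k (h (m≤n⇒m≤1+n i≤k) p))
  respects {c = true ∷ _} h = respects (λ i≤k p → branch-below true i≤k (h (m≤n⇒m≤1+n i≤k) p))

module Refutation (c : Vec Bool m) (δ : Axiom) where
  open Countermodel m (λ ε → ε ∈ K c × ε ≢ δ) public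

  M⊮α : ¬ M ⊩ α
  M⊮α = ⊮α (map′ (here refl ,_) proj₂ (¬? (entry m ≟ᵃ δ)))

  M⊩K : ε ∈ K c → ε ≢ δ → M ⊩ ε
  M⊩K ε∈K ε≢δ = K-sound ε∈K (ε∈K , ε≢δ)

  respects-c : Respects c
  respects-c = respects λ _ (p , _) → chain-part p
    where
    chain-part : branch i ∈ K c → branch i ∈ chain c
    chain-part (there (there (there p))) = p

  M⊩β-if-δ∈K : δ ∈ K c → M ⊩ β⟨ c ∷ bs ⟩
  M⊩β-if-δ∈K {bs = bs} δ∈K = ⊩β-if-¬AboveAll {bs = c ∷ bs} λ p-entry (above-c , h) →
    let p-spur , p-loop = ∃s∃rV⇒spur×loop (AboveAll⇒∃s∃rV bs h)
    in proj₂ (All.lookup (p-entry ∷ p-spur ∷ p-loop ∷ above-self⇒chain respects-c above-c) δ∈K) refl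

  M⊩β-if-≺ : c ≺ d → M ⊩ β⟨ d ∷ bs ⟩
  M⊩β-if-≺ {d = d} {bs = bs} c≺d = ⊩β-if-¬AboveAll {bs = d ∷ bs} λ _ (above-d , _) →
    ≺⇒⋡ c≺d (above⇒≼ respects-c above-d)

  M⊩J : δ ∈ β⟨ c ∷ bs ⟩ ∷ K c → ε ∈ β⟨ c ∷ bs ⟩ ∷ K c → ε ≢ δ → M ⊩ ε
  M⊩J (here refl) (here refl) ε≢δ = ⊥-elim (ε≢δ refl)
  M⊩J {bs = bs} (there δ∈K) (here refl) _ = M⊩β-if-δ∈K {bs = bs} δ∈K
  M⊩J _ (there ε∈K) ε≢δ = M⊩K ε∈K ε≢δ

HasAtomicLHS : Axiom → Set
HasAtomicLHS (atom _ ⊑ _) = ⊤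
HasAtomicLHS _ = ⊥

K-atomic : {c : Vec Bool m} → All HasAtomicLHS (K c)
K-atomic = tt ∷ tt ∷ tt ∷ chain-atomic
  where
  chain-atomic : {c : Vec Bool k} → All HasAtomicLHS (chain c)
  chain-atomic {c = []} = tt ∷ []
  chain-atomic {c = false ∷ _} = tt ∷ chain-atomic
  chain-atomic {c = true ∷ _} = tt ∷ tt ∷ chain-atomic

∉K : ¬ HasAtomicLHS δ → δ ∉ K c
∉K ¬atomic δ∈K = ¬atomic (All.lookup K-atomic δ∈K)

chain⊆chain-ones : {c : Vec Bool k} → chain c ⊆ chain (ones k)
chain⊆chain-ones {c = []} = id
chain⊆chain-ones {c = false ∷ _} = ∷⁺ʳ _ (λ p → there (chain⊆chain-ones p))
chain⊆chain-ones {c = true ∷ _} = ∷⁺ʳ _ (∷⁺ʳ _ chain⊆chain-ones)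

K⊆K-ones : {c : Vec Bool m} → K c ⊆ K (ones m)
K⊆K-ones = ∷⁺ʳ _ (∷⁺ʳ _ (∷⁺ʳ _ chain⊆chain-ones))

weaker-by-countermodel : (∀ I → I ⊩ δ → I ⊩ γ) → I ⊩ γ → ¬ I ⊩ δ → Weaker γ δ
weaker-by-countermodel {δ = δ} {γ = γ} δ⇒γ I⊩γ I⊮δ =
  (λ _ γ⊨ε I′ I′⊩δ → γ⊨ε I′ (only (δ⇒γ I′ (I′⊩δ δ (here refl)))))
  , δ , (λ I′ I′⊩δ → I′⊩δ δ (here refl)) , λ γ⊨δ → I⊮δ (γ⊨δ _ (only I⊩γ))
  where
  only : I ⊩ γ → ∀ ε → ε ∈ [ γ ] → I ⊩ ε
  only I⊩γ _ (here refl) = I⊩γ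

replace-head : δ ∉ O → (∀ ε → ε ∈ γ ∷ O → (ε ∈ δ ∷ O × ε ≢ δ) ⊎ ε ≡ γ)
                     × (∀ ε → (ε ∈ δ ∷ O × ε ≢ δ) ⊎ ε ≡ γ → ε ∈ γ ∷ O)
replace-head δ∉O = to , from
  where
  to : ∀ ε → ε ∈ _ ∷ _ → _
  to _ (here refl) = inj₂ refl
  to _ (there ε∈O) = inj₁ (there ε∈O , λ { refl → δ∉O ε∈O })
  from : ∀ ε → _ → ε ∈ _ ∷ _
  from _ (inj₁ (here refl , ε≢δ)) = ⊥-elim (ε≢δ refl)
  from _ (inj₁ (there ε∈O , _)) = there ε∈O
  from _ (inj₂ refl) = here refl

justification : {c : Vec Bool m} {bs : List (Vec Bool m)} → All (_≼ c) bs
              → IsJustification [] (β⟨ c ∷ bs ⟩ ∷ K (ones m)) (β⟨ c ∷ bs ⟩ ∷ K c) α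
justification {c = c} {bs = bs} bs≼c = ∷⁺ʳ _ K⊆K-ones , ⊨⇒∪ₚ⊨ {δ = α} id (K⊨α (≼-refl ∷ bs≼c)) , minimal
  where
  minimal : ∀ J′ → J′ ⊆ (β⟨ c ∷ bs ⟩ ∷ K c) → ([] ∪ₚ J′) ⊨ₚ α → (β⟨ c ∷ bs ⟩ ∷ K c) ⊆ J′
  minimal J′ J′⊆J J′⊨α {δ} δ∈J with δ ∈? J′
  ... | yes δ∈J′ = δ∈J′
  ... | no δ∉J′ = ⊥-elim (M⊮α (J′⊨α M M⊩J′))
    where
    open Refutation c δ
    M⊩J′ : ∀ ε → ([] ∪ₚ J′) ε → M ⊩ ε
    M⊩J′ _ (inj₂ ε∈J′) = M⊩J δ∈J (J′⊆J ε∈J′) λ { refl → δ∉J′ ε∈J′ }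

repair-step : {c : Vec Bool m} {bs : List (Vec Bool m)} {γ : Axiom} → All (_≼ c) bs
            → (∀ I → I ⊩ β⟨ c ∷ bs ⟩ → I ⊩ γ) → Refutation.M c β⟨ c ∷ bs ⟩ ⊩ γ
            → RepairStep [] α (β⟨ c ∷ bs ⟩ ∷ K (ones m)) (γ ∷ K (ones m))
repair-step {c = c} {bs = bs} {γ = γ} bs≼c β⇒γ M⊩γ =
  ⊨⇒∪ₚ⊨ {δ = α} (∷⁺ʳ _ K⊆K-ones) J⊨α , _ , _ , _ , justification bs≼c , here refl
  , weaker-by-countermodel β⇒γ M⊩γ M⊮β , J-β+γ⊭α , replace-head (∉K λ ())
  where
  open Refutation c β⟨ c ∷ bs ⟩
  J⊨α = K⊨α (≼-refl ∷ bs≼c)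
  M⊮β : ¬ M ⊩ β⟨ c ∷ bs ⟩
  M⊮β M⊩β = M⊮α (J⊨α M λ
    { _ (here refl) → M⊩β
    ; _ (there ε∈K) → M⊩J (here refl) (there ε∈K) (λ { refl → ∉K (λ ()) ε∈K }) })
  J-β+γ⊭α : ¬ ((λ ε → ε ∈ [] ⊎ (ε ∈ β⟨ c ∷ bs ⟩ ∷ K c × ε ≢ β⟨ c ∷ bs ⟩) ⊎ ε ≡ γ) ⊨ₚ α)
  J-β+γ⊭α ent = M⊮α (ent M λ
    { _ (inj₂ (inj₁ (ε∈J , ε≢β))) → M⊩J (here refl) ε∈J ε≢β
    ; _ (inj₂ (inj₂ refl)) → M⊩γ })

next-step : {c d : Vec Bool m} {bs : List (Vec Bool m)} → All (_≼ c) bs → c ≺ d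
          → RepairStep [] α (β⟨ c ∷ bs ⟩ ∷ K (ones m)) (β⟨ d ∷ c ∷ bs ⟩ ∷ K (ones m))
next-step {c = c} {bs = bs} bs≼c c≺d =
  repair-step bs≼c (λ _ I⊩β e (Ae , (_ , h)) → I⊩β e (Ae , h)) (Refutation.M⊩β-if-≺ c _ {bs = c ∷ bs} c≺d)

last-step : {c : Vec Bool m} {bs : List (Vec Bool m)} → All (_≼ c) bs
          → RepairStep [] α (β⟨ c ∷ bs ⟩ ∷ K (ones m)) (⊤⊑⊤ ∷ K (ones m))
last-step bs≼c = repair-step bs≼c (λ _ _ _ _ → tt) (λ _ _ → tt)

⊤⊑⊤+K⊭α : ¬ ([] ∪ₚ (⊤⊑⊤ ∷ K (ones m))) ⊨ₚ α
⊤⊑⊤+K⊭α ent = M⊮α (ent M λ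
  { _ (inj₂ (here refl)) _ _ → tt
  ; _ (inj₂ (there ε∈K)) → M⊩K ε∈K (λ { refl → ∉K (λ ()) ε∈K }) })
  where open Refutation (ones _) ⊤⊑⊤

run : {c : Vec Bool m} {bs : List (Vec Bool m)} {L : List (Vec Bool m)} → All (_≼ c) bs → Linked _≺_ (c ∷ L)
    → Run [] α (β⟨ c ∷ bs ⟩ ∷ K (ones m)) (length (c ∷ L))
run bs≼c [-] = step (last-step bs≼c) (done ⊤⊑⊤+K⊭α)
run bs≼c (c≺d ∷ ascending) =
  step (next-step bs≼c c≺d) (run (c≼d ∷ All.map (λ b≼c → ≼-trans b≼c c≼d) bs≼c) ascending)
  where c≼d = ≺⇒≼ c≺d

bitVectors : (m : ℕ) → List (Vec Bool m)
bitVectors zero = [ [] ]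
bitVectors (suc m) = map (false ∷_) (bitVectors m) ++ map (true ∷_) (bitVectors m)

length-bitVectors : ∀ m → length (bitVectors m) ≡ 2 ^ m
length-bitVectors zero = refl
length-bitVectors (suc m) = begin
  length (map (false ∷_) (bitVectors m) ++ map (true ∷_) (bitVectors m))
    ≡⟨ length-++ (map (false ∷_) (bitVectors m)) ⟩
  length (map (false ∷_) (bitVectors m)) + length (map (true ∷_) (bitVectors m))
    ≡⟨ cong₂ _+_ (length-map (false ∷_) (bitVectors m)) (length-map (true ∷_) (bitVectors m)) ⟩
  length (bitVectors m) + length (bitVectors m)
    ≡⟨ cong₂ _+_ (length-bitVectors m) (length-bitVectors m) ⟩
  2 ^ m + 2 ^ m
    ≡⟨ cong (2 ^ m +_) (sym (+-identityʳ (2 ^ m))) ⟩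
  2 ^ suc m ∎
  where open ≡-Reasoning

bitVectors-ascending : ∀ m → AllPairs _≺_ (bitVectors m)
bitVectors-ascending zero = [] AllPairs.∷ AllPairs.[]
bitVectors-ascending (suc m) = AllPairs.++⁺ (prefixed false) (prefixed true)
  (All.map⁺ (All.universal (λ _ → All.map⁺ (All.universal (λ _ → 0≺1) _)) _))
  where
  prefixed : ∀ x → AllPairs _≺_ (map (x ∷_) (bitVectors m))
  prefixed x = AllPairs.map⁺ (AllPairs.map (x ∷_) (bitVectors-ascending m))

bitVectors-head : ∀ m → ∃[ L ] bitVectors m ≡ zeros m ∷ L
bitVectors-head zero = [] , refl
bitVectors-head (suc m) with bitVectors m | bitVectors-head m
... | _ | _ , refl = _ , refl

run-𝔒 : ∀ m → Run [] α (𝔒 m) (2 ^ m)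
run-𝔒 m with bitVectors-head m
... | L , enum = subst (Run [] α (𝔒 m)) counted (run [] ascending)
  where
  ascending : Linked _≺_ (zeros m ∷ L)
  ascending = subst (Linked _≺_) enum (AllPairs⇒Linked (bitVectors-ascending m))
  counted : length (zeros m ∷ L) ≡ 2 ^ m
  counted = trans (cong length (sym enum)) (length-bitVectors m)

size-Above-zeros : ∀ m → conceptSize (Above (zeros m)) ≡ 2 + m
size-Above-zeros zero = refl
size-Above-zeros (suc m) = cong suc (size-Above-zeros m)

size-chain-ones : ∀ m → ontologySize (chain (ones m)) ≡ 3 + m * 7
size-chain-ones zero = refl
size-chain-ones (suc m) = cong (7 +_) (size-chain-ones m)

size-𝔒 : ∀ m → ontologySize (𝔒 m) ≡ 19 + m * 8
size-𝔒 m rewrite size-Above-zeros m | size-chain-ones m = arithmetic m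
  where
  arithmetic : ∀ m → 1 + (2 + m + 3) + 1 + (2 + (3 + (4 + (3 + m * 7)))) ≡ 19 + m * 8
  arithmetic = solve-∀


19+8m≤27m : ∀ m → 1 ≤ m → 19 + m * 8 ≤ m * 27
19+8m≤27m m@(suc _) _ = subst (19 + m * 8 ≤_) (sym (*-distribˡ-+ m 19 8)) (+-monoˡ-≤ (m * 8) (m≤n*m 19 m))

2^-growth : ∀ {s} n → s ≤ n * 27 → 2 ^ s ≤ (2 ^ n) ^ 27
2^-growth {s} n s≤27n = subst (2 ^ s ≤_) (sym (^-*-assoc 2 n 27)) (^-monoʳ-≤ 2 s≤27n)

proposition6 : Σ Axiom λ α → Σ (ℕ → Ontology) λ O → Σ ℕ λ c →
    ( (1 ≤ c)
    × (∀ (n : ℕ) → 1 ≤ n →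
        ( (([] ∪ₚ O n) ⊨ₚ α)
        × (n ≤ ontologySize (O n))
        × Σ ℕ λ k → (Run [] α (O n) k × (2 ^ ontologySize (O n) ≤ k ^ c)))))
proposition6 = α , 𝔒 , 27 , s≤s z≤n , λ n 1≤n →
    ⊨⇒∪ₚ⊨ {δ = α} id (K⊨α (≼-ones ∷ []))
  , subst (n ≤_) (sym (size-𝔒 n)) (≤-trans (m≤m*n n 8) (m≤n+m (n * 8) 19))
  , 2 ^ n , run-𝔒 n
  , 2^-growth n (subst (_≤ n * 27) (sym (size-𝔒 n)) (19+8m≤27m n 1≤n))
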